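{- Let $\Gamma$ be an Abelian group with $|\Gamma|\ge 3$ and let $G$ be an $r$-regular graph with vertices $v_1,\dots,v_n$. Let $g,g_1\in\Gamma$, and let $H_1,\dots,H_n$ be graphs such that each $H_i$ has a $\Gamma$-vertex magic labeling $\ell_i$ with magic constant $g_1$ and $\sum_{x\in V(H_i)}\ell_i(x)=g$. Then $G[H_1,H_2,\dots,H_n]$ is $\Gamma$-vertex magic.
   Context: Graphs are finite, simple and undirected. For an additive Abelian group $\Gamma$ with identity $0$ and a graph $G$, a $\Gamma$-vertex magic labeling is a map $\ell:V(G)\to\Gamma\setminus\{0\}$ for which there is $\mu\in\Gamma$ (the magic constant) with $w(v)=\sum_{u\in N(v)}\ell(u)=\mu$ for every vertex $v$; $G$ is $\Gamma$-vertex magic if it has such a labeling. The generalized composition $G[H_1,\dots,H_n]$ has vertex set $\{(v_i,h): 1\le i\le n,\ h\in V(H_i)\}$, with $(v_i,h)\sim(v_j,h')$ iff $v_i\sim v_j$ in $G$, or $i=j$ and $h\sim h'$ in $H_i$. -}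

module Defs where

open import Level using (Level; _⊔_)
open import Data.Nat using (ℕ; zero; suc)
open import Data.Bool using (Bool; true; false; if_then_else_; _∨_)
open import Data.Fin using (Fin; _≟_)
open import Data.List using (List; []; _∷_; map; concatMap; allFin)
open import Data.List.Membership.Propositional using (_∈_)
open import Data.List.Relation.Unary.Unique.Propositional using (Unique)
open import Data.Product using (Σ; ∃; ∃-syntax; _×_; _,_)
open import Relation.Binary.PropositionalEquality using (_≡_)
open import Relation.Nullary using (¬_; yes; no)
open import Algebra.Bundles using (AbelianGroup)

record Graph : Set₁ where
  field
    V     : Set
    verts : List V
    adj   : V → V → Bool
open Graph public

record IsSimpleGraph (G : Graph) : Set where
  field
    complete : ∀ v → v ∈ verts G
    unique   : Unique (verts G)
    symmetric  : ∀ u v → adj G u v ≡ adj G v u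
    irreflexive : ∀ v → adj G v v ≡ false

countB : {A : Set} → (A → Bool) → List A → ℕ
countB p [] = 0
countB p (x ∷ xs) = if p x then suc (countB p xs) else countB p xs

degree : (G : Graph) → V G → ℕ
degree G v = countB (adj G v) (verts G)

Regular : ℕ → Graph → Set
Regular r G = ∀ v → degree G v ≡ r

finGraph : (n : ℕ) → (Fin n → Fin n → Bool) → Graph
finGraph n a = record { V = Fin n ; verts = allFin n ; adj = a }

compAdj : (n : ℕ) (a : Fin n → Fin n → Bool) (H : Fin n → Graph) →
          Σ (Fin n) (λ i → V (H i)) → Σ (Fin n) (λ i → V (H i)) → Bool
compAdj n a H (i , h) (j , h') with i ≟ j
... | yes _≡_.refl = a i i ∨ adj (H i) h h'
... | no _ = a i j

composition : (n : ℕ) → (Fin n → Fin n → Bool) → (Fin n → Graph) → Graph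
composition n a H = record
  { V = Σ (Fin n) (λ i → V (H i))
  ; verts = concatMap (λ i → map (λ h → (i , h)) (verts (H i))) (allFin n)
  ; adj = compAdj n a H }

module _ {c ℓ : Level} (Γ : AbelianGroup c ℓ) where
  open AbelianGroup Γ renaming (Carrier to A)

  sumΓ : List A → A
  sumΓ [] = ε
  sumΓ (x ∷ xs) = x ∙ sumΓ xs

  weight : (G : Graph) → (V G → A) → V G → A
  weight G lab v = sumΓ (wl (verts G))
    where
    wl : List (V G) → List A
    wl [] = []
    wl (u ∷ us) = if adj G v u then lab u ∷ wl us else wl us

  NonzeroLabeling : (G : Graph) → (V G → A) → Set ℓ
  NonzeroLabeling G lab = ∀ v → ¬ (lab v ≈ ε)

  IsVertexMagicLabeling : (G : Graph) → (V G → A) → A → Set ℓ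
  IsVertexMagicLabeling G lab μ =
    NonzeroLabeling G lab × (∀ v → weight G lab v ≈ μ)

  IsVertexMagic : Graph → Set (c ⊔ ℓ)
  IsVertexMagic G = ∃[ lab ] ∃[ μ ] IsVertexMagicLabeling G lab μ

  AtLeast3 : Set (c ⊔ ℓ)
  AtLeast3 = ∃[ a ] ∃[ b ] ∃[ d ] (¬ a ≈ b) × (¬ a ≈ d) × (¬ b ≈ d)

{-# OPTIONS --safe #-}
-- Label the vertex (vᵢ , h) of G[H₁,…,Hₙ] by ℓᵢ(h). Its neighbours are all
-- of H_j for each neighbour v_j of vᵢ, contributing the total label g, and the
-- neighbours of h inside Hᵢ, contributing the magic constant g₁; so every
-- weight equals r·g + g₁.
module Submission where

open import Defs
open import Level using (Level)
open import Data.Nat using (ℕ)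
open import Data.Bool using (Bool; true; false; if_then_else_)
open import Data.Fin using (Fin; _≟_)
open import Data.List using (List; []; _∷_; map; _++_; concatMap; allFin)
open import Data.List.Properties using (map-++; map-∘)
open import Data.List.Membership.Propositional using (_∈_; _∉_)
open import Data.List.Membership.Propositional.Properties using (∈-allFin)
open import Data.List.Relation.Unary.All.Properties using (All¬⇒¬Any)
open import Data.List.Relation.Unary.Any using (here; there)
open import Data.List.Relation.Unary.AllPairs using (_∷_)
open import Data.List.Relation.Unary.Unique.Propositional using (Unique)
open import Data.List.Relation.Unary.Unique.Propositional.Properties using (allFin⁺)
open import Data.Product using (∃-syntax; _×_; _,_; proj₁; proj₂; uncurry)
open import Algebra.Bundles using (AbelianGroup)
open import Relation.Nullary using (yes; no; does; contradiction)
open import Relation.Binary.Definitions using (DecidableEquality)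
open import Relation.Binary.PropositionalEquality using (_≡_)
import Relation.Binary.PropositionalEquality as ≡
import Algebra.Properties.CommutativeSemigroup as CommutativeSemigroupProperties
import Algebra.Properties.Monoid.Mult as MonoidMult
import Relation.Binary.Reasoning.Setoid as SetoidReasoning

module _ {c ℓ : Level} (Γ : AbelianGroup c ℓ) where
  open AbelianGroup Γ renaming (Carrier to A)
  open CommutativeSemigroupProperties commutativeSemigroup using (interchange)
  open MonoidMult monoid using () renaming (_×_ to _·_)
  open SetoidReasoning setoid

  when : Bool → A → A
  when b x = if b then x else ε

  when-congʳ : (b : Bool) {x y : A} → x ≈ y → when b x ≈ when b y
  when-congʳ true  x≈y = x≈y
  when-congʳ false x≈y = refl

  sumΓ-++ : (xs ys : List A) → sumΓ Γ (xs ++ ys) ≈ sumΓ Γ xs ∙ sumΓ Γ ys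
  sumΓ-++ []       ys = sym (identityˡ _)
  sumΓ-++ (x ∷ xs) ys = trans (∙-congˡ (sumΓ-++ xs ys)) (sym (assoc _ _ _))

  sumΓ-if-∷ : (b : Bool) (x : A) (xs : List A) →
              sumΓ Γ (if b then x ∷ xs else xs) ≈ when b x ∙ sumΓ Γ xs
  sumΓ-if-∷ true  x xs = refl
  sumΓ-if-∷ false x xs = sym (identityˡ _)

  module _ {X : Set} where

    sumΓ-cong : {f f′ : X → A} → (∀ x → f x ≈ f′ x) →
                (xs : List X) → sumΓ Γ (map f xs) ≈ sumΓ Γ (map f′ xs)
    sumΓ-cong f≈f′ []       = refl
    sumΓ-cong f≈f′ (x ∷ xs) = ∙-cong (f≈f′ x) (sumΓ-cong f≈f′ xs)

    sumΓ-ε : (xs : List X) → sumΓ Γ (map (λ _ → ε) xs) ≈ ε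
    sumΓ-ε []       = refl
    sumΓ-ε (x ∷ xs) = trans (identityˡ _) (sumΓ-ε xs)

    sumΓ-map-∙ : (f f′ : X → A) (xs : List X) →
                 sumΓ Γ (map (λ x → f x ∙ f′ x) xs) ≈ sumΓ Γ (map f xs) ∙ sumΓ Γ (map f′ xs)
    sumΓ-map-∙ f f′ []       = sym (identityˡ ε)
    sumΓ-map-∙ f f′ (x ∷ xs) = trans (∙-congˡ (sumΓ-map-∙ f f′ xs)) (interchange _ _ _ _)

    sumΓ-concatMap : {Y : Set} (f : Y → A) (F : X → List Y) (xs : List X) →
                     sumΓ Γ (map f (concatMap F xs)) ≈ sumΓ Γ (map (λ x → sumΓ Γ (map f (F x))) xs)
    sumΓ-concatMap f F []       = refl
    sumΓ-concatMap f F (x ∷ xs) = begin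
      sumΓ Γ (map f (F x ++ concatMap F xs))                 ≡⟨ ≡.cong (sumΓ Γ) (map-++ f (F x) (concatMap F xs)) ⟩
      sumΓ Γ (map f (F x) ++ map f (concatMap F xs))         ≈⟨ sumΓ-++ (map f (F x)) _ ⟩
      sumΓ Γ (map f (F x)) ∙ sumΓ Γ (map f (concatMap F xs)) ≈⟨ ∙-congˡ (sumΓ-concatMap f F xs) ⟩
      sumΓ Γ (map f (F x)) ∙ sumΓ Γ (map (λ x → sumΓ Γ (map f (F x))) xs) ∎

    sumΓ-when : (b : Bool) (f : X → A) (xs : List X) →
                sumΓ Γ (map (λ x → when b (f x)) xs) ≈ when b (sumΓ Γ (map f xs))
    sumΓ-when true  f xs = refl
    sumΓ-when false f xs = sumΓ-ε xs

    sumΓ-when-count : (p : X → Bool) (z : A) (xs : List X) →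
                      sumΓ Γ (map (λ x → when (p x) z) xs) ≈ countB p xs · z
    sumΓ-when-count p z []       = refl
    sumΓ-when-count p z (x ∷ xs) with p x
    ... | true  = ∙-congˡ (sumΓ-when-count p z xs)
    ... | false = trans (identityˡ _) (sumΓ-when-count p z xs)

    sumΓ-unique : (f : X → A) {s : List X → A} → s [] ≈ ε → (∀ x xs → s (x ∷ xs) ≈ f x ∙ s xs) →
                  (xs : List X) → s xs ≈ sumΓ Γ (map f xs)
    sumΓ-unique f s[] s∷ []       = s[]
    sumΓ-unique f s[] s∷ (x ∷ xs) = trans (s∷ x xs) (∙-congˡ (sumΓ-unique f s[] s∷ xs))

    module _ (_≟ₓ_ : DecidableEquality X) (i : X) (z : A) where

      sumΓ-delta-∉ : (xs : List X) → i ∉ xs →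
                     sumΓ Γ (map (λ j → when (does (i ≟ₓ j)) z) xs) ≈ ε
      sumΓ-delta-∉ []       i∉xs = refl
      sumΓ-delta-∉ (x ∷ xs) i∉xs with i ≟ₓ x
      ... | yes i≡x = contradiction (here i≡x) i∉xs
      ... | no  _   = trans (identityˡ _) (sumΓ-delta-∉ xs (λ i∈xs → i∉xs (there i∈xs)))

      sumΓ-delta : (xs : List X) → Unique xs → i ∈ xs →
                   sumΓ Γ (map (λ j → when (does (i ≟ₓ j)) z) xs) ≈ z
      sumΓ-delta (x ∷ xs) (x∉xs ∷ _) (here ≡.refl) with i ≟ₓ i
      ... | yes _   = trans (∙-congˡ (sumΓ-delta-∉ xs (All¬⇒¬Any x∉xs))) (identityʳ z)
      ... | no  i≢i = contradiction ≡.refl i≢i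
      sumΓ-delta (x ∷ xs) (x∉xs ∷ unique) (there i∈xs) with i ≟ₓ x
      ... | yes ≡.refl = contradiction i∈xs (All¬⇒¬Any x∉xs)
      ... | no  _      = trans (identityˡ _) (sumΓ-delta xs unique i∈xs)

  -- `weight` sums a list built by a function local to its definition, which
  -- cannot be named here; elaborating `sumΓ-unique` before with-abstracting
  -- `verts G` lets unification instantiate `s` with that local recursion.
  weight-as-sum : (G : Graph) (lab : V G → A) (v : V G) →
                  weight Γ G lab v ≈ sumΓ Γ (map (λ u → when (adj G v u) (lab u)) (verts G))
  weight-as-sum G lab v
    with sumΓ-unique _ refl (λ u _ → sumΓ-if-∷ (adj G v u) (lab u) _) | verts G
  ... | recursion | us = recursion us

  module _ (n : ℕ) (a : Fin n → Fin n → Bool) (H : Fin n → Graph)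
           (lab : ∀ i → V (H i) → A) where

    total : Fin n → A
    total j = sumΓ Γ (map (lab j) (verts (H j)))

    weight-composition-block :
      (∀ i → a i i ≡ false) → ∀ i h j →
      sumΓ Γ (map (λ h′ → when (compAdj n a H (i , h) (j , h′)) (lab j h′)) (verts (H j)))
        ≈ when (a i j) (total j) ∙ when (does (i ≟ j)) (weight Γ (H i) (lab i) h)
    weight-composition-block loopless i h j with i ≟ j
    ... | yes ≡.refl rewrite loopless i = begin
      sumΓ Γ (map (λ h′ → when (adj (H i) h h′) (lab i h′)) (verts (H i)))
        ≈⟨ sym (weight-as-sum (H i) (lab i) h) ⟩
      weight Γ (H i) (lab i) h
        ≈⟨ sym (identityˡ _) ⟩
      ε ∙ weight Γ (H i) (lab i) h
        ∎
    ... | no _ = trans (sumΓ-when (a i j) (lab j) (verts (H j))) (sym (identityʳ _))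

    weight-composition :
      (∀ i → a i i ≡ false) → ∀ i h →
      weight Γ (composition n a H) (uncurry lab) (i , h)
        ≈ sumΓ Γ (map (λ j → when (a i j) (total j)) (allFin n)) ∙ weight Γ (H i) (lab i) h
    weight-composition loopless i h = begin
      weight Γ (composition n a H) (uncurry lab) (i , h)
        ≈⟨ weight-as-sum (composition n a H) (uncurry lab) (i , h) ⟩
      sumΓ Γ (map neighbourLabel (concatMap copy (allFin n)))
        ≈⟨ sumΓ-concatMap neighbourLabel copy (allFin n) ⟩
      sumΓ Γ (map (λ j → sumΓ Γ (map neighbourLabel (copy j))) (allFin n))
        ≈⟨ sumΓ-cong block (allFin n) ⟩
      sumΓ Γ (map (λ j → when (a i j) (total j) ∙ when (does (i ≟ j)) (weight Γ (H i) (lab i) h)) (allFin n))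
        ≈⟨ sumΓ-map-∙ _ _ (allFin n) ⟩
      sumΓ Γ (map (λ j → when (a i j) (total j)) (allFin n)) ∙
      sumΓ Γ (map (λ j → when (does (i ≟ j)) (weight Γ (H i) (lab i) h)) (allFin n))
        ≈⟨ ∙-congˡ (sumΓ-delta _≟_ i _ (allFin n) (allFin⁺ n) (∈-allFin i)) ⟩
      sumΓ Γ (map (λ j → when (a i j) (total j)) (allFin n)) ∙ weight Γ (H i) (lab i) h
        ∎
      where
      neighbourLabel : V (composition n a H) → A
      neighbourLabel u = when (compAdj n a H (i , h) u) (uncurry lab u)
      copy : (j : Fin n) → List (V (composition n a H))
      copy j = map (j ,_) (verts (H j))
      block : ∀ j → sumΓ Γ (map neighbourLabel (copy j))
                    ≈ when (a i j) (total j) ∙ when (does (i ≟ j)) (weight Γ (H i) (lab i) h)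
      block j = trans (reflexive (≡.sym (≡.cong (sumΓ Γ) (map-∘ (verts (H j))))))
                      (weight-composition-block loopless i h j)

theorem3p9 : {c ℓ : Level} (Γ : AbelianGroup c ℓ) → AtLeast3 Γ →
    (n r : ℕ) (a : Fin n → Fin n → Bool) →
    IsSimpleGraph (finGraph n a) → Regular r (finGraph n a) →
    (g g₁ : AbelianGroup.Carrier Γ) →
    (H : Fin n → Graph) → (∀ i → IsSimpleGraph (H i)) →
    (∀ i → ∃[ lab ] (IsVertexMagicLabeling Γ (H i) lab g₁ ×
                     AbelianGroup._≈_ Γ (sumΓ Γ (map lab (verts (H i)))) g)) →
    IsVertexMagic Γ (composition n a H)
theorem3p9 Γ _ n r a simple regular g g₁ H _ magic =
  uncurry lab , r · g ∙ g₁ , (λ (i , h) → proj₁ (isMagic i) h) , magicWeight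
  where
  open AbelianGroup Γ
  open MonoidMult monoid using (×-congˡ) renaming (_×_ to _·_)
  open SetoidReasoning setoid
  lab : ∀ i → V (H i) → Carrier
  lab i = proj₁ (magic i)
  isMagic : ∀ i → IsVertexMagicLabeling Γ (H i) (lab i) g₁
  isMagic i = proj₁ (proj₂ (magic i))
  total≈g : ∀ j → total Γ n a H lab j ≈ g
  total≈g j = proj₂ (proj₂ (magic j))
  magicWeight : ∀ v → weight Γ (composition n a H) (uncurry lab) v ≈ r · g ∙ g₁
  magicWeight (i , h) = begin
    weight Γ (composition n a H) (uncurry lab) (i , h)
      ≈⟨ weight-composition Γ n a H lab (IsSimpleGraph.irreflexive simple) i h ⟩
    sumΓ Γ (map (λ j → when Γ (a i j) (total Γ n a H lab j)) (allFin n)) ∙ weight Γ (H i) (lab i) h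
      ≈⟨ ∙-cong (sumΓ-cong Γ (λ j → when-congʳ Γ (a i j) (total≈g j)) (allFin n)) (proj₂ (isMagic i) h) ⟩
    sumΓ Γ (map (λ j → when Γ (a i j) g) (allFin n)) ∙ g₁
      ≈⟨ ∙-congʳ (sumΓ-when-count Γ (a i) g (allFin n)) ⟩
    degree (finGraph n a) i · g ∙ g₁
      ≈⟨ ∙-congʳ (×-congˡ (regular i)) ⟩
    r · g ∙ g₁
      ∎
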